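{- Let $X=[n]$ and let $\mathcal{A},\mathcal{B}\subset\mathcal{P}(X)$ be left-compressed families. Then \[ \frac{c(\mathcal{A},\mathcal{B})}{n!}\ge\frac{c(\mathcal{A})}{n!}\cdot\frac{c(\mathcal{B})}{n!}. \]
   Context: A family $\mathcal{A}\subset\mathcal{P}([n])$ is left-compressed if for any $1\le i<j\le n$, whenever $A\in\mathcal{A}$ with $i\notin A$, $j\in A$, also $(A\setminus\{j\})\cup\{i\}\in\mathcal{A}$. A maximal chain in $\mathcal{P}(X)$ is a sequence $C_0\subset C_1\subset\cdots\subset C_n$ of subsets of $X$ with $|C_i|=i$; there are $n!$ of them. $c(\mathcal{A})$ denotes the number of maximal chains containing some element of $\mathcal{A}$, and $c(\mathcal{A},\mathcal{B})$ the number of maximal chains that contain an element of $\mathcal{A}$ and an element of $\mathcal{B}$. -}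

module Defs where

open import Level using (0ℓ)
open import Data.Bool using (Bool; true; false)
open import Data.Nat using (ℕ; zero; suc; _<_)
open import Data.Fin using (Fin; toℕ; inject₁) renaming (suc to fsuc)
open import Data.Fin.Subset using (Subset; _∈_; _∉_; _⊆_; ∣_∣; inside; outside)
open import Data.Fin.Subset.Properties using (_⊆?_)
open import Data.Fin.Properties using (all?; any?)
open import Data.Vec using (Vec; []; _∷_; lookup; _[_]≔_)
open import Data.List using (List; []; _∷_; map; concatMap; filter; length)
open import Data.Product using (Σ; _×_; _,_)
open import Relation.Unary using (Pred; Decidable)
open import Relation.Nullary using (Dec; yes; no)
open import Relation.Nullary.Decidable using (_×-dec_)
open import Relation.Binary.PropositionalEquality using (_≡_)
open import Data.Nat.Properties using (_≟_)

Family : ℕ → Set₁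
Family n = Pred (Subset n) 0ℓ

LeftCompressed : ∀ {n} → Family n → Set
LeftCompressed {n} 𝒜 =
  (i j : Fin n) → toℕ i < toℕ j → (A : Subset n) → 𝒜 A → i ∉ A → j ∈ A →
  𝒜 ((A [ j ]≔ outside) [ i ]≔ inside)

IsMaximalChain : ∀ {n} → Vec (Subset n) (suc n) → Set
IsMaximalChain {n} C =
  ((i : Fin (suc n)) → ∣ lookup C i ∣ ≡ toℕ i) ×
  ((i : Fin n) → lookup C (inject₁ i) ⊆ lookup C (fsuc i))

isMaximalChain? : ∀ {n} → Decidable (IsMaximalChain {n})
isMaximalChain? C =
  all? (λ i → ∣ lookup C i ∣ ≟ toℕ i) ×-dec
  all? (λ i → lookup C (inject₁ i) ⊆? lookup C (fsuc i))

allSubsets : (n : ℕ) → List (Subset n)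
allSubsets zero    = [] ∷ []
allSubsets (suc n) = concatMap (λ s → map (s ∷_) (allSubsets n)) (outside ∷ inside ∷ [])

allSeqs : ∀ {n} (m : ℕ) → List (Vec (Subset n) m)
allSeqs {n} zero    = [] ∷ []
allSeqs {n} (suc m) = concatMap (λ A → map (A ∷_) (allSeqs m)) (allSubsets n)

maximalChains : (n : ℕ) → List (Vec (Subset n) (suc n))
maximalChains n = filter isMaximalChain? (allSeqs (suc n))

Meets : ∀ {n} → Family n → Vec (Subset n) (suc n) → Set
Meets 𝒜 C = Σ (Fin _) λ i → 𝒜 (lookup C i)

meets? : ∀ {n} (𝒜 : Family n) → Decidable 𝒜 → Decidable (Meets 𝒜)
meets? 𝒜 𝒜? C = any? (λ i → 𝒜? (lookup C i))

c₁ : ∀ {n} (𝒜 : Family n) → Decidable 𝒜 → ℕ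
c₁ {n} 𝒜 𝒜? = length (filter (meets? 𝒜 𝒜?) (maximalChains n))

c₂ : ∀ {n} (𝒜 ℬ : Family n) → Decidable 𝒜 → Decidable ℬ → ℕ
c₂ {n} 𝒜 ℬ 𝒜? ℬ? =
  length (filter (λ C → meets? 𝒜 𝒜? C ×-dec meets? ℬ ℬ? C) (maximalChains n))

-- Count chains from the bottom up. For a set S with k elements missing, let h𝒜(S) be the number
-- of saturated chains from S up to [n] that hit 𝒜: it is k! if S ∈ 𝒜 and Σ_{z ∉ S} h𝒜(S ∪ {z})
-- otherwise. Left-compression makes z ↦ h𝒜(S ∪ {z}) non-increasing (shifting an element of a set
-- to a smaller one can only create hitting chains), so the sequences for 𝒜 and for ℬ are
-- similarly ordered, and Chebyshev's sum inequality gives h𝒜(S) · hℬ(S) ≤ h𝒜ℬ(S) · k! by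
-- induction on k. The theorem is the case S = ∅, k = n.

module Submission where

open import Defs
open import Data.Bool using (Bool; true; false; if_then_else_)
import Data.Bool as Bool
open import Data.Nat using (ℕ; zero; suc; _+_; _*_; _≤_; _<_; z≤n; s≤s; s≤s⁻¹; _!)
open import Data.Nat.Properties
open import Data.Nat.ListAction using () renaming (sum to sumᴸ)
open import Data.Nat.ListAction.Properties using () renaming (sum-++ to sumᴸ-++)
open import Data.Fin using (Fin; toℕ; inject₁) renaming (zero to fzero; suc to fsuc)
open import Data.Fin.Subset using (Subset; inside; outside; _⊆_; ∣_∣; ⊥)
open import Data.Fin.Properties using (toℕ-injective; any?) renaming (_≟_ to _≟ᶠ_; <⇒≢ to <⇒≢ᶠ)
import Data.Fin.Permutation as Perm
open import Data.Fin.Permutation.Components using (transpose)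
open import Data.Fin.Subset.Properties using (drop-∷-⊆; out⊆; in⊆in; p⊆q⇒∣p∣≤∣q∣; ∣⊥∣≡0)
open import Data.Vec using (Vec; []; _∷_; lookup; _[_]≔_; head; here)
open import Data.Vec.Properties
  using (≡-dec; ∷-injectiveʳ; []≔-commutes; []≔-idempotent; []≔-lookup; lookup∘update; lookup∘update′; []=⇒lookup; lookup⇒[]=)
open import Data.List using (List; []; _∷_; map; concatMap; filter; length; _++_)
open import Data.List.Properties
  using (length-++; filter-++; filter-≐; filter-none; filter-accept; map-++; map-∘; map-cong; ++-identityʳ)
import Data.List.Relation.Unary.All as All
open import Data.Product using (Σ; _×_; _,_; proj₁; proj₂)
open import Data.Unit using (tt)
open import Function using (_∘_; id)
open import Function.Bundles using (_⇔_; mk⇔; Equivalence)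
open import Level using (Level)
open import Relation.Unary using (Pred; Decidable)
open import Relation.Unary.Properties using (_∩?_; U?)
open import Relation.Nullary using (Dec; yes; no; does; ¬_; contradiction)
open import Relation.Nullary.Decidable using (_×-dec_; dec-true; dec-false)
open import Relation.Binary.PropositionalEquality
open import Relation.Binary using (tri<; tri≈; tri>)
open import Algebra.Properties.CommutativeMonoid.Sum +-0-commutativeMonoid
  using (sum; sum-cong-≗; ∑-comm; ∑-distrib-+; sum-permute)
open import Algebra.Properties.Semiring.Sum +-*-semiring using (*-distribˡ-sum; *-distribʳ-sum)
open import Data.Nat.Tactic.RingSolver using (solve-∀)
open import Algebra.Properties.CommutativeSemigroup *-commutativeSemigroup using (x∙yz≈y∙xz)
open import Data.Product.Function.NonDependent.Propositional using (_×-⇔_)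

module _ {a p q : Level} {A : Set a} {P : Pred A p} {Q : Pred A q}
         (P? : Decidable P) (Q? : Decidable Q) where

  length-filter-mono : (∀ x → P x → Q x) → ∀ xs → length (filter P? xs) ≤ length (filter Q? xs)
  length-filter-mono P⇒Q []       = z≤n
  length-filter-mono P⇒Q (x ∷ xs) with P? x | Q? x
  ... | yes _  | yes _  = s≤s (length-filter-mono P⇒Q xs)
  ... | yes px | no ¬qx = contradiction (P⇒Q x px) ¬qx
  ... | no _   | yes _  = m≤n⇒m≤1+n (length-filter-mono P⇒Q xs)
  ... | no _   | no _   = length-filter-mono P⇒Q xs

  length-filter-cong : (∀ x → P x ⇔ Q x) → ∀ xs → length (filter P? xs) ≡ length (filter Q? xs)
  length-filter-cong P⇔Q xs =
    cong length (filter-≐ P? Q? ((λ {x} → Equivalence.to (P⇔Q x)) , (λ {x} → Equivalence.from (P⇔Q x))) xs)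

  length-filter-filter : ∀ xs → length (filter Q? (filter P? xs)) ≡ length (filter (P? ∩? Q?) xs)
  length-filter-filter []       = refl
  length-filter-filter (x ∷ xs) with P? x
  ... | no _ = length-filter-filter xs
  ... | yes _ with Q? x
  ...   | yes _ = cong suc (length-filter-filter xs)
  ...   | no _  = length-filter-filter xs

length-filter-none : ∀ {a p} {A : Set a} {P : Pred A p} (P? : Decidable P) →
                     (∀ x → ¬ P x) → ∀ xs → length (filter P? xs) ≡ 0
length-filter-none P? ¬P xs = cong length (filter-none P? (All.universal ¬P xs))

module _ {a b p : Level} {A : Set a} {B : Set b} {P : Pred B p} (P? : Decidable P) where

  length-filter-map : (f : A → B) → ∀ xs → length (filter P? (map f xs)) ≡ length (filter (λ x → P? (f x)) xs)
  length-filter-map f []       = refl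
  length-filter-map f (x ∷ xs) with P? (f x)
  ... | yes _ = cong suc (length-filter-map f xs)
  ... | no _  = length-filter-map f xs

  length-filter-concatMap : (f : A → List B) → ∀ xs →
    length (filter P? (concatMap f xs)) ≡ sumᴸ (map (λ x → length (filter P? (f x))) xs)
  length-filter-concatMap f []       = refl
  length-filter-concatMap f (x ∷ xs) = begin
    length (filter P? (f x ++ concatMap f xs))
      ≡⟨ cong length (filter-++ P? (f x) (concatMap f xs)) ⟩
    length (filter P? (f x) ++ filter P? (concatMap f xs))
      ≡⟨ length-++ (filter P? (f x)) ⟩
    length (filter P? (f x)) + length (filter P? (concatMap f xs))
      ≡⟨ cong (length (filter P? (f x)) +_) (length-filter-concatMap f xs) ⟩
    length (filter P? (f x)) + sumᴸ (map (λ x → length (filter P? (f x))) xs) ∎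
    where open ≡-Reasoning

-- Sums over all subsets

∑Subsets : (n : ℕ) → (Subset n → ℕ) → ℕ
∑Subsets n h = sumᴸ (map h (allSubsets n))

∑Subsets-cong : ∀ n {g h : Subset n → ℕ} → (∀ T → g T ≡ h T) → ∑Subsets n g ≡ ∑Subsets n h
∑Subsets-cong n g≗h = cong sumᴸ (map-cong g≗h (allSubsets n))

∑Subsets-suc : ∀ n (h : Subset (suc n) → ℕ) →
               ∑Subsets (suc n) h ≡ ∑Subsets n (λ T → h (outside ∷ T)) + ∑Subsets n (λ T → h (inside ∷ T))
∑Subsets-suc n h = begin
  sumᴸ (map h (map (outside ∷_) Ts ++ (map (inside ∷_) Ts ++ [])))
    ≡⟨ cong (λ ys → sumᴸ (map h (map (outside ∷_) Ts ++ ys))) (++-identityʳ _) ⟩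
  sumᴸ (map h (map (outside ∷_) Ts ++ map (inside ∷_) Ts))
    ≡⟨ cong sumᴸ (map-++ h (map (outside ∷_) Ts) _) ⟩
  sumᴸ (map h (map (outside ∷_) Ts) ++ map h (map (inside ∷_) Ts))
    ≡⟨ sumᴸ-++ (map h (map (outside ∷_) Ts)) _ ⟩
  sumᴸ (map h (map (outside ∷_) Ts)) + sumᴸ (map h (map (inside ∷_) Ts))
    ≡⟨ sym (cong₂ _+_ (cong sumᴸ (map-∘ Ts)) (cong sumᴸ (map-∘ Ts))) ⟩
  ∑Subsets n (λ T → h (outside ∷ T)) + ∑Subsets n (λ T → h (inside ∷ T)) ∎
  where open ≡-Reasoning
        Ts = allSubsets n

∑Subsets-zero : ∀ n (h : Subset n → ℕ) → (∀ T → h T ≡ 0) → ∑Subsets n h ≡ 0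
∑Subsets-zero zero    h h≡0 = cong (_+ 0) (h≡0 [])
∑Subsets-zero (suc n) h h≡0 = trans (∑Subsets-suc n h)
  (cong₂ _+_ (∑Subsets-zero n _ (λ T → h≡0 (outside ∷ T))) (∑Subsets-zero n _ (λ T → h≡0 (inside ∷ T))))

∑Subsets-point : ∀ n (S : Subset n) (h : Subset n → ℕ) → (∀ T → T ≢ S → h T ≡ 0) → ∑Subsets n h ≡ h S
∑Subsets-point zero    []           h _   = +-identityʳ (h [])
∑Subsets-point (suc n) (outside ∷ S) h off = begin
  ∑Subsets (suc n) h
    ≡⟨ ∑Subsets-suc n h ⟩
  ∑Subsets n (λ T → h (outside ∷ T)) + ∑Subsets n (λ T → h (inside ∷ T))
    ≡⟨ cong₂ _+_ (∑Subsets-point n S _ (λ T T≢S → off (outside ∷ T) (T≢S ∘ ∷-injectiveʳ)))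
                 (∑Subsets-zero n _ (λ T → off (inside ∷ T) λ ())) ⟩
  h (outside ∷ S) + 0
    ≡⟨ +-identityʳ _ ⟩
  h (outside ∷ S) ∎
  where open ≡-Reasoning
∑Subsets-point (suc n) (inside ∷ S)  h off = trans (∑Subsets-suc n h)
  (cong₂ _+_ (∑Subsets-zero n _ (λ T → off (outside ∷ T) λ ()))
             (∑Subsets-point n S _ (λ T T≢S → off (inside ∷ T) (T≢S ∘ ∷-injectiveʳ))))

length-filter-allSeqs : ∀ {n ℓ} m {P : Pred (Vec (Subset n) (suc m)) ℓ} (P? : Decidable P) →
  length (filter P? (allSeqs (suc m))) ≡ ∑Subsets n (λ A → length (filter (λ W → P? (A ∷ W)) (allSeqs m)))
length-filter-allSeqs {n} m P? = trans (length-filter-concatMap P? (λ A → map (A ∷_) (allSeqs m)) (allSubsets n))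
  (∑Subsets-cong n (λ A → length-filter-map P? (A ∷_) (allSeqs m)))

_≟ˢ_ : ∀ {n} (S T : Subset n) → Dec (S ≡ T)
_≟ˢ_ = ≡-dec Bool._≟_

insert : ∀ {n} → Subset n → Fin n → Subset n
insert S z = S [ z ]≔ inside

∁-indicator : ∀ {n} → Subset n → Fin n → ℕ
∁-indicator S z = if lookup S z then 0 else 1

missing : ∀ {n} → Subset n → ℕ
missing S = sum (∁-indicator S)

atSuccessor : ∀ {n} → Subset n → (Subset n → ℕ) → Fin n → ℕ
atSuccessor S h z = if lookup S z then 0 else h (insert S z)

missing-⊥ : ∀ n → missing (⊥ {n}) ≡ n
missing-⊥ zero    = refl
missing-⊥ (suc n) = cong suc (missing-⊥ n)

missing-insert : ∀ {n} (S : Subset n) z → lookup S z ≡ outside → suc (missing (insert S z)) ≡ missing S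
missing-insert (outside ∷ S) fzero    _  = refl
missing-insert (outside ∷ S) (fsuc z) z∉S = cong suc (missing-insert S z z∉S)
missing-insert (inside  ∷ S) (fsuc z) z∉S = missing-insert S z z∉S

missing-insert-suc : ∀ {n k} (S : Subset n) z → lookup S z ≡ outside → missing S ≡ suc k → missing (insert S z) ≡ k
missing-insert-suc S z z∉S missing≡ = suc-injective (trans (missing-insert S z z∉S) missing≡)

atSuccessor-cong : ∀ {n} (S : Subset n) {g h : Subset n → ℕ} →
  (∀ z → lookup S z ≡ outside → g (insert S z) ≡ h (insert S z)) → ∀ z → atSuccessor S g z ≡ atSuccessor S h z
atSuccessor-cong S g≡h z with lookup S z in z∈?S
... | inside  = refl
... | outside = g≡h z z∈?S

sum-atSuccessor-const : ∀ {n} (S : Subset n) c → sum (atSuccessor S (λ _ → c)) ≡ missing S * c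
sum-atSuccessor-const []            c = refl
sum-atSuccessor-const (outside ∷ S) c = cong (c +_) (sum-atSuccessor-const S c)
sum-atSuccessor-const (inside  ∷ S) c = sum-atSuccessor-const S c

-- S ⋖ᵇ T iff T is S with exactly one element added.
_⋖ᵇ_ : ∀ {n} → Subset n → Subset n → Bool
[]            ⋖ᵇ []            = false
(outside ∷ S) ⋖ᵇ (outside ∷ T) = S ⋖ᵇ T
(outside ∷ S) ⋖ᵇ (inside  ∷ T) = does (S ≟ˢ T)
(inside  ∷ S) ⋖ᵇ (inside  ∷ T) = S ⋖ᵇ T
(inside  ∷ S) ⋖ᵇ (outside ∷ T) = false

∑Subsets-≟ : ∀ n (S : Subset n) (h : Subset n → ℕ) → ∑Subsets n (λ T → if does (S ≟ˢ T) then h T else 0) ≡ h S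
∑Subsets-≟ n S h = trans (∑Subsets-point n S _ off) (cong (λ b → if b then h S else 0) (dec-true (S ≟ˢ S) refl))
  where
  off : ∀ T → T ≢ S → (if does (S ≟ˢ T) then h T else 0) ≡ 0
  off T T≢S with S ≟ˢ T
  ... | yes S≡T = contradiction (sym S≡T) T≢S
  ... | no _    = refl

∑Subsets-⋖ᵇ : ∀ n (S : Subset n) (h : Subset n → ℕ) →
              ∑Subsets n (λ T → if S ⋖ᵇ T then h T else 0) ≡ sum (atSuccessor S h)
∑Subsets-⋖ᵇ zero    []            h = refl
∑Subsets-⋖ᵇ (suc n) (outside ∷ S) h = begin
  ∑Subsets (suc n) (λ T → if (outside ∷ S) ⋖ᵇ T then h T else 0)
    ≡⟨ ∑Subsets-suc n _ ⟩
  ∑Subsets n (λ T → if S ⋖ᵇ T then h (outside ∷ T) else 0)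
    + ∑Subsets n (λ T → if does (S ≟ˢ T) then h (inside ∷ T) else 0)
    ≡⟨ cong₂ _+_ (∑Subsets-⋖ᵇ n S (λ T → h (outside ∷ T))) (∑Subsets-≟ n S (λ T → h (inside ∷ T))) ⟩
  sum (atSuccessor S (λ T → h (outside ∷ T))) + h (inside ∷ S)
    ≡⟨ +-comm _ (h (inside ∷ S)) ⟩
  sum (atSuccessor (outside ∷ S) h) ∎
  where open ≡-Reasoning
∑Subsets-⋖ᵇ (suc n) (inside ∷ S)  h = trans (∑Subsets-suc n _)
  (cong₂ _+_ (∑Subsets-zero n _ (λ _ → refl)) (∑Subsets-⋖ᵇ n S (λ T → h (inside ∷ T))))

-- Saturated chains

module _ {n : ℕ} where

  Chain : ∀ k → Subset n → Vec (Subset n) (suc k) → Set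
  Chain zero    S (C ∷ []) = C ≡ S
  Chain (suc k) S (C ∷ W)  = C ≡ S × S ⋖ᵇ head W ≡ true × Chain k (head W) W

  chain? : ∀ k (S : Subset n) → Decidable (Chain k S)
  chain? zero    S (C ∷ []) = C ≟ˢ S
  chain? (suc k) S (C ∷ W)  = C ≟ˢ S ×-dec (S ⋖ᵇ head W) Bool.≟ true ×-dec chain? k (head W) W

  Chain-head : ∀ k {S} V → Chain k S V → head V ≡ S
  Chain-head zero    (C ∷ []) C≡S       = C≡S
  Chain-head (suc k) (C ∷ W)  (C≡S , _) = C≡S

  countChains : ∀ {ℓ} k → Subset n → {Q : Pred (Vec (Subset n) (suc k)) ℓ} → Decidable Q → ℕ
  countChains k S Q? = length (filter (chain? k S ∩? Q?) (allSeqs {n} (suc k)))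

  module _ {ℓ} k (S : Subset n) {Q : Pred (Vec (Subset n) (suc k)) ℓ} (Q? : Decidable Q) where

    countChains-head : countChains k S Q? ≡ length (filter (λ W → chain? k S (S ∷ W) ×-dec Q? (S ∷ W)) (allSeqs {n} k))
    countChains-head = trans (length-filter-allSeqs {n} k (chain? k S ∩? Q?))
      (∑Subsets-point n S _ λ A A≢S → length-filter-none _ (λ W (c , _) → A≢S (Chain-head k (A ∷ W) c)) (allSeqs {n} k))

    countChains-mono : ∀ {ℓ′} {P : Pred (Vec (Subset n) (suc k)) ℓ′} (P? : Decidable P) →
                       (∀ V → P V → Q V) → countChains k S P? ≤ countChains k S Q?
    countChains-mono P? P⇒Q = length-filter-mono _ _ (λ V (c , p) → c , P⇒Q V p) (allSeqs {n} (suc k))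

    countChains-cong : ∀ {ℓ′} {P : Pred (Vec (Subset n) (suc k)) ℓ′} (P? : Decidable P) →
                       (∀ V → Chain k S V → P V ⇔ Q V) → countChains k S P? ≡ countChains k S Q?
    countChains-cong P? P⇔Q = length-filter-cong _ _
      (λ V → mk⇔ (λ (c , p) → c , Equivalence.to (P⇔Q V c) p) (λ (c , q) → c , Equivalence.from (P⇔Q V c) q))
      (allSeqs {n} (suc k))

  countChains-suc : ∀ {ℓ ℓ′} k (S : Subset n)
    {R : Pred (Vec (Subset n) (suc (suc k))) ℓ} (R? : Decidable R)
    {Q : Pred (Vec (Subset n) (suc k)) ℓ′} (Q? : Decidable Q) →
    (∀ W → R (S ∷ W) ⇔ Q W) → countChains (suc k) S R? ≡ sum (atSuccessor S (λ T → countChains k T Q?))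
  countChains-suc k S R? Q? R⇔Q = begin
    countChains (suc k) S R?
      ≡⟨ countChains-head (suc k) S R? ⟩
    length (filter (λ W → chain? (suc k) S (S ∷ W) ×-dec R? (S ∷ W)) (allSeqs {n} (suc k)))
      ≡⟨ length-filter-cong _ _ (λ W → mk⇔ (λ ((_ , c , ch) , r) → c , ch , Equivalence.to (R⇔Q W) r)
                                              (λ (c , ch , q) → (refl , c , ch) , Equivalence.from (R⇔Q W) q))
                            (allSeqs {n} (suc k)) ⟩
    length (filter (λ W → (S ⋖ᵇ head W) Bool.≟ true ×-dec chain? k (head W) W ×-dec Q? W) (allSeqs {n} (suc k)))
      ≡⟨ length-filter-allSeqs {n} k _ ⟩
    ∑Subsets n (λ T → length (filter (λ W → (S ⋖ᵇ T) Bool.≟ true ×-dec chain? k T (T ∷ W) ×-dec Q? (T ∷ W))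
                                     (allSeqs {n} k)))
      ≡⟨ ∑Subsets-cong n chainsThrough ⟩
    ∑Subsets n (λ T → if S ⋖ᵇ T then countChains k T Q? else 0)
      ≡⟨ ∑Subsets-⋖ᵇ n S (λ T → countChains k T Q?) ⟩
    sum (atSuccessor S (λ T → countChains k T Q?)) ∎
    where
    open ≡-Reasoning
    chainsThrough : ∀ T →
      length (filter (λ W → (S ⋖ᵇ T) Bool.≟ true ×-dec chain? k T (T ∷ W) ×-dec Q? (T ∷ W)) (allSeqs {n} k))
        ≡ (if S ⋖ᵇ T then countChains k T Q? else 0)
    chainsThrough T with S ⋖ᵇ T
    ... | true  = trans (length-filter-cong _ _ (λ W → mk⇔ proj₂ (refl ,_)) (allSeqs {n} k)) (sym (countChains-head k T Q?))
    ... | false = length-filter-none _ (λ W → λ ()) (allSeqs {n} k)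

  countChains-all : ∀ k (S : Subset n) → missing S ≡ k → countChains k S U? ≡ k !
  countChains-all zero    S _ = trans (countChains-head 0 S U?)
    (cong length (filter-accept (λ W → chain? 0 S (S ∷ W) ×-dec U? (S ∷ W)) {[]} {[]} (refl , tt)))
  countChains-all (suc k) S missing≡ = begin
    countChains (suc k) S U?
      ≡⟨ countChains-suc k S U? U? (λ _ → mk⇔ (λ _ → tt) (λ _ → tt)) ⟩
    sum (atSuccessor S (λ T → countChains k T U?))
      ≡⟨ sum-cong-≗ (atSuccessor-cong S {λ T → countChains k T U?} λ z z∉S →
           countChains-all k (insert S z) (missing-insert-suc S z z∉S missing≡)) ⟩
    sum (atSuccessor S (λ _ → k !))
      ≡⟨ sum-atSuccessor-const S (k !) ⟩
    missing S * k !
      ≡⟨ cong (_* k !) missing≡ ⟩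
    suc k ! ∎
    where open ≡-Reasoning

p⊆q⇒∣q∣≤∣p∣⇒p≡q : ∀ {m} (p q : Subset m) → p ⊆ q → ∣ q ∣ ≤ ∣ p ∣ → p ≡ q
p⊆q⇒∣q∣≤∣p∣⇒p≡q []            []            _   _ = refl
p⊆q⇒∣q∣≤∣p∣⇒p≡q (outside ∷ p) (outside ∷ q) p⊆q ∣q∣≤∣p∣ =
  cong (outside ∷_) (p⊆q⇒∣q∣≤∣p∣⇒p≡q p q (drop-∷-⊆ p⊆q) ∣q∣≤∣p∣)
p⊆q⇒∣q∣≤∣p∣⇒p≡q (inside  ∷ p) (inside  ∷ q) p⊆q ∣q∣≤∣p∣ =
  cong (inside ∷_) (p⊆q⇒∣q∣≤∣p∣⇒p≡q p q (drop-∷-⊆ p⊆q) (s≤s⁻¹ ∣q∣≤∣p∣))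
p⊆q⇒∣q∣≤∣p∣⇒p≡q (inside  ∷ p) (outside ∷ q) p⊆q _ with () ← p⊆q here
p⊆q⇒∣q∣≤∣p∣⇒p≡q (outside ∷ p) (inside  ∷ q) p⊆q ∣q∣≤∣p∣ =
  contradiction (≤-trans ∣q∣≤∣p∣ (p⊆q⇒∣p∣≤∣q∣ (drop-∷-⊆ p⊆q))) (<-irrefl refl)

∣p∣≡0⇒p≡⊥ : ∀ {m} (p : Subset m) → ∣ p ∣ ≡ 0 → p ≡ ⊥
∣p∣≡0⇒p≡⊥ []            _      = refl
∣p∣≡0⇒p≡⊥ (outside ∷ p) ∣p∣≡0 = cong (outside ∷_) (∣p∣≡0⇒p≡⊥ p ∣p∣≡0)

⋖ᵇ-complete : ∀ {m} (C D : Subset m) → C ⊆ D → ∣ D ∣ ≡ suc ∣ C ∣ → C ⋖ᵇ D ≡ true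
⋖ᵇ-complete []            []            _   ()
⋖ᵇ-complete (outside ∷ C) (outside ∷ D) C⊆D ∣D∣≡ = ⋖ᵇ-complete C D (drop-∷-⊆ C⊆D) ∣D∣≡
⋖ᵇ-complete (inside  ∷ C) (inside  ∷ D) C⊆D ∣D∣≡ = ⋖ᵇ-complete C D (drop-∷-⊆ C⊆D) (suc-injective ∣D∣≡)
⋖ᵇ-complete (inside  ∷ C) (outside ∷ D) C⊆D _ with () ← C⊆D here
⋖ᵇ-complete (outside ∷ C) (inside  ∷ D) C⊆D ∣D∣≡ =
  dec-true (C ≟ˢ D) (p⊆q⇒∣q∣≤∣p∣⇒p≡q C D (drop-∷-⊆ C⊆D) (≤-reflexive (suc-injective ∣D∣≡)))

⋖ᵇ-sound : ∀ {m} (C D : Subset m) → C ⋖ᵇ D ≡ true → C ⊆ D × ∣ D ∣ ≡ suc ∣ C ∣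
⋖ᵇ-sound []            []            ()
⋖ᵇ-sound (outside ∷ C) (outside ∷ D) C⋖D = let (C⊆D , ∣D∣≡) = ⋖ᵇ-sound C D C⋖D in out⊆ C⊆D , ∣D∣≡
⋖ᵇ-sound (inside  ∷ C) (inside  ∷ D) C⋖D = let (C⊆D , ∣D∣≡) = ⋖ᵇ-sound C D C⋖D in in⊆in C⊆D , cong suc ∣D∣≡
⋖ᵇ-sound (outside ∷ C) (inside  ∷ D) C⋖D with C ≟ˢ D
... | yes refl = out⊆ id , refl

module _ {n : ℕ} where

  GradedChain : ∀ k → ℕ → Vec (Subset n) (suc k) → Set
  GradedChain k d V = ((i : Fin (suc k)) → ∣ lookup V i ∣ ≡ d + toℕ i) ×
                      ((i : Fin k) → lookup V (inject₁ i) ⊆ lookup V (fsuc i))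

  GradedChain⇒Chain : ∀ k d V → GradedChain k d V → Chain k (head V) V
  GradedChain⇒Chain zero    d (C ∷ [])     _                = refl
  GradedChain⇒Chain (suc k) d (C ∷ D ∷ W) (sizes , steps) =
    refl , ⋖ᵇ-complete C D (steps fzero) ∣D∣≡ ,
    GradedChain⇒Chain k (suc d) (D ∷ W) ((λ i → trans (sizes (fsuc i)) (+-suc d (toℕ i))) , (λ i → steps (fsuc i)))
    where
    ∣D∣≡ : ∣ D ∣ ≡ suc ∣ C ∣
    ∣D∣≡ = trans (sizes (fsuc fzero)) (trans (+-suc d 0) (cong suc (sym (sizes fzero))))

  Chain⇒GradedChain : ∀ k d V → ∣ head V ∣ ≡ d → Chain k (head V) V → GradedChain k d V
  Chain⇒GradedChain zero    d (C ∷ [])     ∣C∣≡d _ = (λ { fzero → trans ∣C∣≡d (sym (+-identityʳ d)) }) , λ ()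
  Chain⇒GradedChain (suc k) d (C ∷ D ∷ W) ∣C∣≡d (_ , C⋖D , chain) =
    let (C⊆D , ∣D∣≡) = ⋖ᵇ-sound C D C⋖D
        (sizes , steps) = Chain⇒GradedChain k (suc d) (D ∷ W) (trans ∣D∣≡ (cong suc ∣C∣≡d)) chain
    in (λ { fzero → trans ∣C∣≡d (sym (+-identityʳ d)) ; (fsuc i) → trans (sizes i) (sym (+-suc d (toℕ i))) }) ,
       (λ { fzero → C⊆D ; (fsuc i) → steps i })

  isMaximalChain⇔Chain : ∀ V → IsMaximalChain {n} V ⇔ Chain n ⊥ V
  isMaximalChain⇔Chain V@(C ∷ _) = mk⇔
    (λ maximal → subst (λ B → Chain n B V) (∣p∣≡0⇒p≡⊥ C (proj₁ maximal fzero)) (GradedChain⇒Chain n 0 V maximal))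
    (λ chain → let C≡⊥ = Chain-head n V chain in
      Chain⇒GradedChain n 0 V (trans (cong ∣_∣ C≡⊥) (∣⊥∣≡0 n)) (subst (λ B → Chain n B V) (sym C≡⊥) chain))

  length-filter-maximalChains : ∀ {ℓ} {Q : Pred (Vec (Subset n) (suc n)) ℓ} (Q? : Decidable Q) →
                                length (filter Q? (maximalChains n)) ≡ countChains n ⊥ Q?
  length-filter-maximalChains Q? = trans (length-filter-filter isMaximalChain? Q? (allSeqs {n} (suc n)))
    (length-filter-cong _ _ (λ V → mk⇔ (λ (m , q) → Equivalence.to (isMaximalChain⇔Chain V) m , q)
                                        (λ (c , q) → Equivalence.from (isMaximalChain⇔Chain V) c , q))
                        (allSeqs {n} (suc n)))

-- Chebyshev's sum inequality

sum-mono-≤ : ∀ {m} {f g : Fin m → ℕ} → (∀ z → f z ≤ g z) → sum f ≤ sum g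
sum-mono-≤ {zero}  f≤g = z≤n
sum-mono-≤ {suc m} f≤g = +-mono-≤ (f≤g fzero) (sum-mono-≤ (λ z → f≤g (fsuc z)))

sum-*-sum-symmetrised : ∀ {m} (f g : Fin m → ℕ) →
  2 * (sum f * sum g) ≡ sum (λ i → sum (λ j → f i * g j + f j * g i))
sum-*-sum-symmetrised f g = begin
  2 * (sum f * sum g)
    ≡⟨ cong₂ _+_ product≡ (trans (+-identityʳ _) (trans product≡ (∑-comm (λ j i → f j * g i)))) ⟩
  sum (λ i → sum (λ j → f i * g j)) + sum (λ i → sum (λ j → f j * g i))
    ≡⟨ sym (∑-distrib-+ (λ i → sum (λ j → f i * g j)) (λ i → sum (λ j → f j * g i))) ⟩
  sum (λ i → sum (λ j → f i * g j) + sum (λ j → f j * g i))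
    ≡⟨ sum-cong-≗ (λ i → sym (∑-distrib-+ (λ j → f i * g j) (λ j → f j * g i))) ⟩
  sum (λ i → sum (λ j → f i * g j + f j * g i)) ∎
  where
  open ≡-Reasoning
  product≡ : sum f * sum g ≡ sum (λ i → sum (λ j → f i * g j))
  product≡ = trans (*-distribʳ-sum (sum g) f) (sum-cong-≗ (λ i → *-distribˡ-sum (f i) g))

rearrangement : ∀ {a b c d} → b ≤ a → d ≤ c → a * d + b * c ≤ a * c + b * d
rearrangement {b = b} {d = d} b≤a d≤c
  with x , refl ← m≤n⇒∃[o]m+o≡n b≤a | y , refl ← m≤n⇒∃[o]m+o≡n d≤c =
  subst ((b + x) * d + b * (d + y) ≤_) (identity b x d y) (m≤m+n _ (x * y))
  where
  identity : ∀ b x d y → (b + x) * d + b * (d + y) + x * y ≡ (b + x) * (d + y) + b * d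
  identity = solve-∀

module _ {n} (S : Subset n) (f g : Fin n → ℕ)
         (f-∈ : ∀ z → lookup S z ≡ inside → f z ≡ 0) (g-∈ : ∀ z → lookup S z ≡ inside → g z ≡ 0)
         (antitone : ∀ i j → lookup S i ≡ outside → lookup S j ≡ outside → toℕ i < toℕ j → f j ≤ f i × g j ≤ g i)
  where

  chebyshev : sum f * sum g ≤ missing S * sum (λ z → f z * g z)
  chebyshev = *-cancelˡ-≤ 2 (begin
    2 * (sum f * sum g)
      ≡⟨ sum-*-sum-symmetrised f g ⟩
    sum (λ i → sum (λ j → f i * g j + f j * g i))
      ≤⟨ sum-mono-≤ (λ i → sum-mono-≤ (weightedPair i)) ⟩
    sum (λ i → sum (λ j → fg i * ∁-indicator S j + fg j * ∁-indicator S i))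
      ≡⟨ sym (sum-*-sum-symmetrised fg (∁-indicator S)) ⟩
    2 * (sum fg * missing S)
      ≡⟨ cong (2 *_) (*-comm (sum fg) (missing S)) ⟩
    2 * (missing S * sum fg) ∎)
    where
    open ≤-Reasoning

    fg : Fin n → ℕ
    fg z = f z * g z

    similarlyOrdered : ∀ i j → lookup S i ≡ outside → lookup S j ≡ outside →
                       f i * g j + f j * g i ≤ fg i + fg j
    similarlyOrdered i j i∉S j∉S with <-cmp (toℕ i) (toℕ j)
    ... | tri< i<j _ _ = let (fj≤fi , gj≤gi) = antitone i j i∉S j∉S i<j in rearrangement fj≤fi gj≤gi
    ... | tri≈ _ i≡j _ rewrite toℕ-injective i≡j = ≤-refl
    ... | tri> _ _ j<i = let (fi≤fj , gi≤gj) = antitone j i j∉S i∉S j<i in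
      subst₂ _≤_ (+-comm (f j * g i) (f i * g j)) (+-comm (fg j) (fg i)) (rearrangement fi≤fj gi≤gj)

    weightedPair : ∀ i j → f i * g j + f j * g i ≤ fg i * ∁-indicator S j + fg j * ∁-indicator S i
    weightedPair i j with lookup S i in i∈?S | lookup S j in j∈?S
    ... | inside  | _       rewrite f-∈ i i∈?S | g-∈ i i∈?S | *-zeroʳ (f j) = z≤n
    ... | outside | inside  rewrite f-∈ j j∈?S | g-∈ j j∈?S | *-zeroʳ (f i) = z≤n
    ... | outside | outside rewrite *-identityʳ (fg i) | *-identityʳ (fg j) = similarlyOrdered i j i∈?S j∈?S

-- Shifting an element of a set

shift : ∀ {n} → Subset n → Fin n → Fin n → Subset n
shift U x y = (U [ y ]≔ outside) [ x ]≔ inside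

module _ {n} (x y : Fin n) where

  lookup-shift-moved : x ≢ y → ∀ U → lookup (shift U x y) y ≡ outside
  lookup-shift-moved x≢y U = trans (lookup∘update′ (x≢y ∘ sym) (U [ y ]≔ outside) inside) (lookup∘update y U outside)

  lookup-shift-other : ∀ U z → z ≢ x → z ≢ y → lookup (shift U x y) z ≡ lookup U z
  lookup-shift-other U z z≢x z≢y = trans (lookup∘update′ z≢x (U [ y ]≔ outside) inside) (lookup∘update′ z≢y U outside)

  insert-shift : x ≢ y → ∀ U → lookup U y ≡ inside → insert (shift U x y) y ≡ insert U x
  insert-shift x≢y U y∈U = begin
    ((U [ y ]≔ outside) [ x ]≔ inside) [ y ]≔ inside  ≡⟨ []≔-commutes (U [ y ]≔ outside) x y x≢y ⟩
    ((U [ y ]≔ outside) [ y ]≔ inside) [ x ]≔ inside  ≡⟨ cong (_[ x ]≔ inside) ([]≔-idempotent U y) ⟩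
    (U [ y ]≔ inside) [ x ]≔ inside                   ≡⟨ cong (λ b → (U [ y ]≔ b) [ x ]≔ inside) (sym y∈U) ⟩
    (U [ y ]≔ lookup U y) [ x ]≔ inside               ≡⟨ cong (_[ x ]≔ inside) ([]≔-lookup U y) ⟩
    U [ x ]≔ inside                                   ∎
    where open ≡-Reasoning

  shift-insert : ∀ S → lookup S y ≡ outside → shift (insert S y) x y ≡ insert S x
  shift-insert S y∉S = begin
    ((S [ y ]≔ inside) [ y ]≔ outside) [ x ]≔ inside  ≡⟨ cong (_[ x ]≔ inside) ([]≔-idempotent S y) ⟩
    (S [ y ]≔ outside) [ x ]≔ inside                  ≡⟨ cong (λ b → (S [ y ]≔ b) [ x ]≔ inside) (sym y∉S) ⟩
    (S [ y ]≔ lookup S y) [ x ]≔ inside               ≡⟨ cong (_[ x ]≔ inside) ([]≔-lookup S y) ⟩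
    S [ x ]≔ inside                                   ∎
    where open ≡-Reasoning

  shift-insert-comm : ∀ U z → z ≢ x → z ≢ y → shift (insert U z) x y ≡ insert (shift U x y) z
  shift-insert-comm U z z≢x z≢y = begin
    ((U [ z ]≔ inside) [ y ]≔ outside) [ x ]≔ inside  ≡⟨ cong (_[ x ]≔ inside) ([]≔-commutes U z y z≢y) ⟩
    ((U [ y ]≔ outside) [ z ]≔ inside) [ x ]≔ inside  ≡⟨ []≔-commutes (U [ y ]≔ outside) z x z≢x ⟩
    ((U [ y ]≔ outside) [ x ]≔ inside) [ z ]≔ inside  ∎
    where open ≡-Reasoning

  missing-shift : x ≢ y → ∀ U → lookup U x ≡ outside → lookup U y ≡ inside → missing (shift U x y) ≡ missing U
  missing-shift x≢y U x∉U y∈U = begin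
    missing (shift U x y)                  ≡⟨ missing-insert (shift U x y) y (lookup-shift-moved x≢y U) ⟨
    suc (missing (insert (shift U x y) y)) ≡⟨ cong (suc ∘ missing) (insert-shift x≢y U y∈U) ⟩
    suc (missing (insert U x))             ≡⟨ missing-insert U x x∉U ⟩
    missing U                              ∎
    where open ≡-Reasoning

  transpose-ˡ : transpose x y x ≡ y
  transpose-ˡ rewrite dec-true (x ≟ᶠ x) refl = refl

  transpose-other : ∀ z → z ≢ x → z ≢ y → transpose x y z ≡ z
  transpose-other z z≢x z≢y rewrite dec-false (z ≟ᶠ x) z≢x | dec-false (z ≟ᶠ y) z≢y = refl

  sum-transpose : (f : Fin n → ℕ) → sum f ≡ sum (λ z → f (transpose x y z))
  sum-transpose f = sum-permute f (Perm.transpose x y)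

-- Chains hitting a family

atSuccessor-∈ : ∀ {n} (S : Subset n) h z → lookup S z ≡ inside → atSuccessor S h z ≡ 0
atSuccessor-∈ S h z z∈S rewrite z∈S = refl

atSuccessor-∉ : ∀ {n} (S : Subset n) h z → lookup S z ≡ outside → atSuccessor S h z ≡ h (insert S z)
atSuccessor-∉ S h z z∉S rewrite z∉S = refl

Hits : ∀ {n m} → Family n → Vec (Subset n) m → Set
Hits 𝒜 V = Σ (Fin _) λ i → 𝒜 (lookup V i)

hits? : ∀ {n m} {𝒜 : Family n} → Decidable 𝒜 → Decidable (Hits {m = m} 𝒜)
hits? 𝒜? V = any? (λ i → 𝒜? (lookup V i))

module _ {n} {𝒜 : Family n} where

  hits-head : ∀ {m S} (V : Vec (Subset n) (suc m)) → head V ≡ S → 𝒜 S → Hits 𝒜 V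
  hits-head (C ∷ _) refl C∈𝒜 = fzero , C∈𝒜

  hits-∷ : ∀ {m S} {W : Vec (Subset n) m} → ¬ 𝒜 S → Hits 𝒜 (S ∷ W) ⇔ Hits 𝒜 W
  hits-∷ S∉𝒜 = mk⇔ (λ { (fzero , S∈𝒜) → contradiction S∈𝒜 S∉𝒜 ; (fsuc i , a) → i , a })
                   (λ (i , a) → fsuc i , a)

module _ {n} {𝒜 : Family n} (𝒜? : Decidable 𝒜) where

  chainsHitting : ℕ → Subset n → ℕ
  chainsHitting k S = countChains k S (hits? 𝒜?)

  chainsHitting-∈ : ∀ k S → 𝒜 S → missing S ≡ k → chainsHitting k S ≡ k !
  chainsHitting-∈ k S S∈𝒜 missing≡ =
    trans (countChains-cong k S U? (hits? 𝒜?)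
             (λ V chain → mk⇔ (λ _ → tt) (λ _ → hits-head V (Chain-head k V chain) S∈𝒜)))
          (countChains-all k S missing≡)

  chainsHitting-≤ : ∀ k S → missing S ≡ k → chainsHitting k S ≤ k !
  chainsHitting-≤ k S missing≡ =
    subst (chainsHitting k S ≤_) (countChains-all k S missing≡) (countChains-mono k S U? (hits? 𝒜?) (λ _ _ → tt))

  chainsHitting-zero-∉ : ∀ S → ¬ 𝒜 S → chainsHitting 0 S ≡ 0
  chainsHitting-zero-∉ S S∉𝒜 = trans (countChains-head 0 S (hits? 𝒜?))
    (length-filter-none (λ W → chain? 0 S (S ∷ W) ×-dec hits? 𝒜? (S ∷ W))
      (λ { [] (_ , fzero , S∈𝒜) → S∉𝒜 S∈𝒜 }) (allSeqs 0))

  chainsHitting-suc-∉ : ∀ k S → ¬ 𝒜 S → chainsHitting (suc k) S ≡ sum (atSuccessor S (chainsHitting k))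
  chainsHitting-suc-∉ k S S∉𝒜 = countChains-suc k S (hits? 𝒜?) (hits? 𝒜?) (λ _ → hits-∷ {𝒜 = 𝒜} S∉𝒜)

  module _ (compressed : LeftCompressed 𝒜) {x y : Fin n} (x<y : toℕ x < toℕ y) where

    private
      x≢y : x ≢ y
      x≢y = <⇒≢ᶠ x<y

    chainsHitting-shift : ∀ k U → lookup U x ≡ outside → lookup U y ≡ inside → missing U ≡ k →
                          chainsHitting k U ≤ chainsHitting k (shift U x y)
    chainsHitting-shift-∉ : ∀ k U → ¬ 𝒜 U → ¬ 𝒜 (shift U x y) →
                            lookup U x ≡ outside → lookup U y ≡ inside → missing U ≡ k →
                            chainsHitting k U ≤ chainsHitting k (shift U x y)

    chainsHitting-shift k U x∉U y∈U missing≡ with 𝒜? (shift U x y) | 𝒜? U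
    ... | yes shifted∈𝒜 | _ = begin
      chainsHitting k U          ≤⟨ chainsHitting-≤ k U missing≡ ⟩
      k !                        ≡⟨ chainsHitting-∈ k (shift U x y) shifted∈𝒜
                                       (trans (missing-shift x y x≢y U x∉U y∈U) missing≡) ⟨
      chainsHitting k (shift U x y) ∎
      where open ≤-Reasoning
    ... | no shifted∉𝒜 | yes U∈𝒜 =
      contradiction (compressed x y x<y U U∈𝒜 (λ x∈U → contradiction (trans (sym ([]=⇒lookup x∈U)) x∉U) λ ())
                                               (lookup⇒[]= y U y∈U))
                    shifted∉𝒜
    ... | no shifted∉𝒜 | no U∉𝒜 = chainsHitting-shift-∉ k U U∉𝒜 shifted∉𝒜 x∉U y∈U missing≡

    chainsHitting-shift-∉ zero    U U∉𝒜 shifted∉𝒜 _ _ _ =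
      ≤-reflexive (trans (chainsHitting-zero-∉ U U∉𝒜) (sym (chainsHitting-zero-∉ (shift U x y) shifted∉𝒜)))
    chainsHitting-shift-∉ (suc k) U U∉𝒜 shifted∉𝒜 x∉U y∈U missing≡ = begin
      chainsHitting (suc k) U
        ≡⟨ chainsHitting-suc-∉ k U U∉𝒜 ⟩
      sum (atSuccessor U (chainsHitting k))
        ≤⟨ sum-mono-≤ step ⟩
      sum (λ z → atSuccessor (shift U x y) (chainsHitting k) (transpose x y z))
        ≡⟨ sum-transpose x y (atSuccessor (shift U x y) (chainsHitting k)) ⟨
      sum (atSuccessor (shift U x y) (chainsHitting k))
        ≡⟨ chainsHitting-suc-∉ k (shift U x y) shifted∉𝒜 ⟨
      chainsHitting (suc k) (shift U x y) ∎
      where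
      open ≤-Reasoning
      -- Reindexing by the transposition of x and y matches U ∪ {x} with (shift U x y) ∪ {y}, the same set,
      -- and U ∪ {z} with (shift U x y) ∪ {z} = shift (U ∪ {z}) x y, which the induction hypothesis handles.
      stepOutside : ∀ z → lookup U z ≡ outside → Dec (z ≡ x) →
                    chainsHitting k (insert U z) ≤ atSuccessor (shift U x y) (chainsHitting k) (transpose x y z)
      stepOutside z _ (yes refl) = ≤-reflexive (sym (begin-equality
        atSuccessor (shift U x y) (chainsHitting k) (transpose x y x)
          ≡⟨ cong (atSuccessor (shift U x y) (chainsHitting k)) (transpose-ˡ x y) ⟩
        atSuccessor (shift U x y) (chainsHitting k) y
          ≡⟨ atSuccessor-∉ (shift U x y) (chainsHitting k) y (lookup-shift-moved x y x≢y U) ⟩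
        chainsHitting k (insert (shift U x y) y)
          ≡⟨ cong (chainsHitting k) (insert-shift x y x≢y U y∈U) ⟩
        chainsHitting k (insert U x) ∎))
      stepOutside z z∉U (no z≢x) = begin
        chainsHitting k (insert U z)
          ≤⟨ chainsHitting-shift k (insert U z) (trans (lookup∘update′ (z≢x ∘ sym) U inside) x∉U)
               (trans (lookup∘update′ (z≢y ∘ sym) U inside) y∈U) (missing-insert-suc U z z∉U missing≡) ⟩
        chainsHitting k (shift (insert U z) x y)
          ≡⟨ cong (chainsHitting k) (shift-insert-comm x y U z z≢x z≢y) ⟩
        chainsHitting k (insert (shift U x y) z)
          ≡⟨ atSuccessor-∉ (shift U x y) (chainsHitting k) z (trans (lookup-shift-other x y U z z≢x z≢y) z∉U) ⟨
        atSuccessor (shift U x y) (chainsHitting k) z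
          ≡⟨ cong (atSuccessor (shift U x y) (chainsHitting k)) (transpose-other x y z z≢x z≢y) ⟨
        atSuccessor (shift U x y) (chainsHitting k) (transpose x y z) ∎
        where
        z≢y : z ≢ y
        z≢y refl = contradiction (trans (sym z∉U) y∈U) λ ()

      step : ∀ z → atSuccessor U (chainsHitting k) z ≤ atSuccessor (shift U x y) (chainsHitting k) (transpose x y z)
      step z with lookup U z in z∈?U
      ... | inside  = z≤n
      ... | outside = stepOutside z z∈?U (z ≟ᶠ x)

    chainsHitting-antitone : ∀ k S → lookup S x ≡ outside → lookup S y ≡ outside → missing S ≡ suc k →
                             chainsHitting k (insert S y) ≤ chainsHitting k (insert S x)
    chainsHitting-antitone k S x∉S y∉S missing≡ =
      subst (chainsHitting k (insert S y) ≤_) (cong (chainsHitting k) (shift-insert x y S y∉S))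
        (chainsHitting-shift k (insert S y) (trans (lookup∘update′ x≢y S inside) x∉S) (lookup∘update y S inside)
                             (missing-insert-suc S y y∉S missing≡))

module _ {n} {𝒜 ℬ : Family n} (𝒜? : Decidable 𝒜) (ℬ? : Decidable ℬ) where

  chainsHittingBoth : ℕ → Subset n → ℕ
  chainsHittingBoth k S = countChains k S (hits? 𝒜? ∩? hits? ℬ?)

  chainsHittingBoth-∈ˡ : ∀ k S → 𝒜 S → chainsHittingBoth k S ≡ chainsHitting ℬ? k S
  chainsHittingBoth-∈ˡ k S S∈𝒜 = countChains-cong k S (hits? ℬ?) (hits? 𝒜? ∩? hits? ℬ?)
    (λ V chain → mk⇔ proj₂ (hits-head V (Chain-head k V chain) S∈𝒜 ,_))

  chainsHittingBoth-∈ʳ : ∀ k S → ℬ S → chainsHittingBoth k S ≡ chainsHitting 𝒜? k S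
  chainsHittingBoth-∈ʳ k S S∈ℬ = countChains-cong k S (hits? 𝒜?) (hits? 𝒜? ∩? hits? ℬ?)
    (λ V chain → mk⇔ proj₁ (_, hits-head V (Chain-head k V chain) S∈ℬ))

  chainsHittingBoth-suc-∉ : ∀ k S → ¬ 𝒜 S → ¬ ℬ S →
                            chainsHittingBoth (suc k) S ≡ sum (atSuccessor S (chainsHittingBoth k))
  chainsHittingBoth-suc-∉ k S S∉𝒜 S∉ℬ = countChains-suc k S (hits? 𝒜? ∩? hits? ℬ?) (hits? 𝒜? ∩? hits? ℬ?)
    (λ _ → hits-∷ {𝒜 = 𝒜} S∉𝒜 ×-⇔ hits-∷ {𝒜 = ℬ} S∉ℬ)

  module _ (𝒜-compressed : LeftCompressed 𝒜) (ℬ-compressed : LeftCompressed ℬ) where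

    chainsHitting-product : ∀ k S → missing S ≡ k →
                            chainsHitting 𝒜? k S * chainsHitting ℬ? k S ≤ chainsHittingBoth k S * k !
    chainsHitting-product-∉ : ∀ k S → ¬ 𝒜 S → ¬ ℬ S → missing S ≡ k →
                              chainsHitting 𝒜? k S * chainsHitting ℬ? k S ≤ chainsHittingBoth k S * k !

    chainsHitting-product k S missing≡ with 𝒜? S | ℬ? S
    ... | yes S∈𝒜 | _ = ≤-reflexive (begin
      chainsHitting 𝒜? k S * chainsHitting ℬ? k S
        ≡⟨ cong (_* chainsHitting ℬ? k S) (chainsHitting-∈ 𝒜? k S S∈𝒜 missing≡) ⟩
      k ! * chainsHitting ℬ? k S
        ≡⟨ *-comm (k !) _ ⟩
      chainsHitting ℬ? k S * k !
        ≡⟨ cong (_* k !) (chainsHittingBoth-∈ˡ k S S∈𝒜) ⟨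
      chainsHittingBoth k S * k ! ∎)
      where open ≡-Reasoning
    ... | no _ | yes S∈ℬ = ≤-reflexive
      (cong₂ _*_ (sym (chainsHittingBoth-∈ʳ k S S∈ℬ)) (chainsHitting-∈ ℬ? k S S∈ℬ missing≡))
    ... | no S∉𝒜 | no S∉ℬ = chainsHitting-product-∉ k S S∉𝒜 S∉ℬ missing≡

    chainsHitting-product-∉ zero S S∉𝒜 _ _ rewrite chainsHitting-zero-∉ 𝒜? S S∉𝒜 = z≤n
    chainsHitting-product-∉ (suc k) S S∉𝒜 S∉ℬ missing≡ = begin
      chainsHitting 𝒜? (suc k) S * chainsHitting ℬ? (suc k) S
        ≡⟨ cong₂ _*_ (chainsHitting-suc-∉ 𝒜? k S S∉𝒜) (chainsHitting-suc-∉ ℬ? k S S∉ℬ) ⟩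
      sum a * sum b
        ≤⟨ chebyshev S a b (atSuccessor-∈ S (chainsHitting 𝒜? k)) (atSuccessor-∈ S (chainsHitting ℬ? k)) antitone ⟩
      missing S * sum (λ z → a z * b z)
        ≤⟨ *-monoʳ-≤ (missing S) (sum-mono-≤ pointwise) ⟩
      missing S * sum (λ z → c z * k !)
        ≡⟨ cong₂ _*_ missing≡ (sym (*-distribʳ-sum (k !) c)) ⟩
      suc k * (sum c * k !)
        ≡⟨ x∙yz≈y∙xz (suc k) (sum c) (k !) ⟩
      sum c * suc k !
        ≡⟨ cong (_* suc k !) (chainsHittingBoth-suc-∉ k S S∉𝒜 S∉ℬ) ⟨
      chainsHittingBoth (suc k) S * suc k ! ∎
      where
      open ≤-Reasoning
      a b c : Fin n → ℕ
      a = atSuccessor S (chainsHitting 𝒜? k)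
      b = atSuccessor S (chainsHitting ℬ? k)
      c = atSuccessor S (chainsHittingBoth k)

      antitone : ∀ i j → lookup S i ≡ outside → lookup S j ≡ outside → toℕ i < toℕ j → a j ≤ a i × b j ≤ b i
      antitone i j i∉S j∉S i<j
        rewrite atSuccessor-∉ S (chainsHitting 𝒜? k) i i∉S | atSuccessor-∉ S (chainsHitting 𝒜? k) j j∉S
              | atSuccessor-∉ S (chainsHitting ℬ? k) i i∉S | atSuccessor-∉ S (chainsHitting ℬ? k) j j∉S =
        chainsHitting-antitone 𝒜? 𝒜-compressed i<j k S i∉S j∉S missing≡ ,
        chainsHitting-antitone ℬ? ℬ-compressed i<j k S i∉S j∉S missing≡

      pointwise : ∀ z → a z * b z ≤ c z * k !
      pointwise z with lookup S z in z∈?S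
      ... | inside  = z≤n
      ... | outside = chainsHitting-product k (insert S z) (missing-insert-suc S z z∈?S missing≡)

theorem6 : (n : ℕ) (𝒜 ℬ : Family n) (𝒜? : Decidable 𝒜) (ℬ? : Decidable ℬ) →
           LeftCompressed 𝒜 → LeftCompressed ℬ →
           c₁ 𝒜 𝒜? * c₁ ℬ ℬ? ≤ c₂ 𝒜 ℬ 𝒜? ℬ? * (n !)
theorem6 n 𝒜 ℬ 𝒜? ℬ? 𝒜-compressed ℬ-compressed = begin
  c₁ 𝒜 𝒜? * c₁ ℬ ℬ?
    ≡⟨ cong₂ _*_ (length-filter-maximalChains (meets? 𝒜 𝒜?)) (length-filter-maximalChains (meets? ℬ ℬ?)) ⟩
  chainsHitting 𝒜? n ⊥ * chainsHitting ℬ? n ⊥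
    ≤⟨ chainsHitting-product 𝒜? ℬ? 𝒜-compressed ℬ-compressed n ⊥ (missing-⊥ n) ⟩
  chainsHittingBoth 𝒜? ℬ? n ⊥ * n !
    ≡⟨ cong (_* n !) (length-filter-maximalChains (meets? 𝒜 𝒜? ∩? meets? ℬ ℬ?)) ⟨
  c₂ 𝒜 ℬ 𝒜? ℬ? * n ! ∎
  where open ≤-Reasoning
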